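{- For all natural numbers $m\ge0$ and $a>3$, $$h_{\varepsilon_m}(a)>2\cdot\underbrace{\mathrm{tow}_a(\cdots(\mathrm{tow}_a}_{m+2\text{ times}}(a+1))\cdots).$$
   Context: $\varepsilon_{ -1}=\omega$; $\varepsilon_m$ ($m\ge0$) is the $m$-th epsilon number; $\mathrm{tow}_0(x)=1$, $\mathrm{tow}_{n+1}(x)=x^{\mathrm{tow}_n(x)}$ (ordinals and natural numbers). Fundamental sequences for limits $\lambda$ written in normal form to base $\varepsilon_j$, $j=l(\lambda)-1$ with $l(\lambda)=\min\{n:\lambda<\varepsilon_n\}$: $\omega[n]=n$; $\varepsilon_j[n]=\mathrm{tow}_n(\varepsilon_{j-1})$ ($j\ge0$); $(\varepsilon_j^{\gamma+1})[n]=\varepsilon_j^{\gamma}\varepsilon_j[n]$; $(\varepsilon_j^{\psi})[n]=\varepsilon_j^{\psi[n]}$ ($\psi$ limit); $(\varepsilon_j^{\psi}(\gamma+1))[n]=\varepsilon_j^{\psi}\gamma+\varepsilon_j^{\psi}[n]$; $(\varepsilon_j^{\psi}\xi)[n]=\varepsilon_j^{\psi}\xi[n]$ ($\xi$ limit); in a sum of several normal-form terms only the last term is replaced. Hardy hierarchy based on $h(x)=x+1$: $h_0(x)=x$, $h_{\alpha+1}(x)=h_\alpha(x+1)$, $h_\lambda(x)=h_{\lambda[x]}(x)$. -}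

module Defs where

open import Data.Nat using (ℕ; zero; suc; _+_; _*_; _^_; _<_)
open import Data.Product using (∃; _×_)
open import Relation.Binary.PropositionalEquality using (_≡_)

-- Ordinal notations below ε_ω, written in (nested) normal form.
--
--   𝟎               = 0
--   ωt γ k ρ        = ω^γ · (k+1) + ρ        (base ε_{-1} = ω, coefficient k+1 ≥ 1)
--   εt j ψ ξ ρ      = ε_j^ψ · ξ + ρ          (base ε_j, j ≥ 0, coefficient ξ < ε_j)
--
-- A sum  t₁ + t₂ + … + t_k  of normal-form terms is a right-nested chain
-- of constructors ending in 𝟎.

data O : Set where
  𝟎  : O
  ωt : O → ℕ → O → O
  εt : ℕ → O → O → O → O

one : O
one = ωt 𝟎 0 𝟎

fin : ℕ → O
fin zero    = 𝟎
fin (suc k) = ωt 𝟎 k 𝟎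

ωmul : O → ℕ → O
ωmul γ zero    = 𝟎
ωmul γ (suc k) = ωt γ k 𝟎

ε : ℕ → O
ε m = εt m one one 𝟎

towω : ℕ → O
towω zero    = one
towω (suc n) = ωt (towω n) 0 𝟎

towε : ℕ → ℕ → O
towε i zero    = one
towε i (suc n) = εt i (towε i n) one 𝟎

-- ε_j[n] = tow_n(ε_{j-1}),  with ε_{-1} = ω
εfs : ℕ → ℕ → O
εfs zero    n = towω n
εfs (suc i) n = towε i n

data Cls : Set where
  isZero : Cls
  isSucc : O → Cls
  isLim  : Cls

liftω : O → ℕ → Cls → Cls
liftω γ k isZero     = isZero
liftω γ k (isSucc β) = isSucc (ωt γ k β)
liftω γ k isLim      = isLim

liftε : ℕ → O → O → Cls → Cls
liftε j ψ ξ isZero     = isZero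
liftε j ψ ξ (isSucc β) = isSucc (εt j ψ ξ β)
liftε j ψ ξ isLim      = isLim

cls : O → Cls
cls 𝟎                          = isZero
cls (ωt 𝟎 k 𝟎)                 = isSucc (fin k)
cls (ωt (ωt _ _ _) k 𝟎)        = isLim
cls (ωt (εt _ _ _ _) k 𝟎)      = isLim
cls (ωt γ k ρ@(ωt _ _ _))      = liftω γ k (cls ρ)
cls (ωt γ k ρ@(εt _ _ _ _))    = liftω γ k (cls ρ)
cls (εt j 𝟎 ξ 𝟎)               = cls ξ
cls (εt j (ωt _ _ _) ξ 𝟎)      = isLim
cls (εt j (εt _ _ _ _) ξ 𝟎)    = isLim
cls (εt j ψ ξ ρ@(ωt _ _ _))    = liftε j ψ ξ (cls ρ)
cls (εt j ψ ξ ρ@(εt _ _ _ _))  = liftε j ψ ξ (cls ρ)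

-- Fundamental sequences  λ[n]  (as in the paper; junk value on non-limits).

ωpre : O → ℕ → O → O
ωpre γ zero    X = X
ωpre γ (suc k) X = ωt γ k X

εpre : ℕ → O → O → O → O
εpre j ψ 𝟎 X = X
εpre j ψ ξ X = εt j ψ ξ X

mutual
  fs : O → ℕ → O
  fs 𝟎 n                         = 𝟎
  fs (ωt γ k 𝟎) n                = ωpre γ k (ωpow γ n)
  fs (ωt γ k ρ@(ωt _ _ _)) n     = ωt γ k (fs ρ n)
  fs (ωt γ k ρ@(εt _ _ _ _)) n   = ωt γ k (fs ρ n)
  fs (εt j 𝟎 ξ 𝟎) n              = fs ξ n
  fs (εt j ψ@(ωt _ _ _) ξ 𝟎) n   = εlast j ψ ξ n (cls ξ)
  fs (εt j ψ@(εt _ _ _ _) ξ 𝟎) n = εlast j ψ ξ n (cls ξ)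
  fs (εt j ψ ξ ρ@(ωt _ _ _)) n   = εt j ψ ξ (fs ρ n)
  fs (εt j ψ ξ ρ@(εt _ _ _ _)) n = εt j ψ ξ (fs ρ n)

  -- (ω^γ)[n]:  ω^δ · ω[n] = ω^δ · n  if γ = δ+1;  ω^{γ[n]} if γ limit
  ωpow : O → ℕ → O
  ωpow γ n = ωpowC γ n (cls γ)

  ωpowC : O → ℕ → Cls → O
  ωpowC γ n isZero     = 𝟎
  ωpowC γ n (isSucc δ) = ωmul δ n
  ωpowC γ n isLim      = ωt (fs γ n) 0 𝟎

  -- (ε_j^ψ ξ)[n] for ψ ≠ 0
  εlast : ℕ → O → O → ℕ → Cls → O
  εlast j ψ ξ n isZero      = 𝟎
  εlast j ψ ξ n (isSucc ξ') = εpre j ψ ξ' (εpow j ψ n (cls ψ))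
  εlast j ψ ξ n isLim       = εt j ψ (fs ξ n) 𝟎

  -- (ε_j^ψ)[n]:  ε_j^δ · ε_j[n]  if ψ = δ+1;  ε_j^{ψ[n]} if ψ limit
  εpow : ℕ → O → ℕ → Cls → O
  εpow j ψ n isZero     = εfs j n
  εpow j ψ n (isSucc δ) = εt j δ (εfs j n) 𝟎
  εpow j ψ n isLim      = εt j (fs ψ n) one 𝟎

-- Hardy hierarchy based on h(x) = x+1, as a (deterministic) graph:
-- H α x y  means  h_α(x) = y.

data H : O → ℕ → ℕ → Set where
  hz : ∀ {α x}     → cls α ≡ isZero   → H α x x
  hs : ∀ {α β x y} → cls α ≡ isSucc β → H β (suc x) y → H α x y
  hl : ∀ {α x y}   → cls α ≡ isLim    → H (fs α x) x y → H α x y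

tow : ℕ → ℕ → ℕ
tow zero    x = 1
tow (suc n) x = x ^ tow n x

iter : (ℕ → ℕ) → ℕ → ℕ → ℕ
iter f zero    x = x
iter f (suc k) x = f (iter f k x)

-- The relation H of Defs evaluates the Hardy hierarchy through the paper's
-- fundamental sequences on normal-form notations.  We transfer it to Brouwer
-- trees (zero, successor, ω-limits), where the Hardy function `hardy` is a total
-- function and sums compose: hardy (s ⊕ t) = hardy s ∘ hardy t.
--
--  1. Tree arithmetic: sums, finite multiples, ω^t, products P ⊗ x and powers
--     of an epsilon tree; trees towω-tree, towε-tree, ε-tree for the notations.
--  2. Simulation: a tree t simulates a notation α when both are zero, both are
--     successors of simulating objects, or both are limits whose fundamental
--     sequences are simulated for every n ≥ 1.  Then H α x (hardy t x) for
--     x ≥ 1, and ε m is simulated by ε-tree m.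
--  3. Growth: with an Ackermann-style hierarchy A we show, for z ≥ 4,
--     hardy (ε-tree m) z ≥ F^(4+m)(z), where F z = S^z(z) and S y = y^y.
--  4. Arithmetic: tow_a w ≤ F w for 1 ≤ a ≤ w and 2y < F y for y ≥ 3 turn this
--     lower bound into the theorem.
module Submission where

open import Defs
open import Data.Nat using (ℕ; zero; suc; _+_; _*_; _^_; _<_; _≤_; z≤n; s≤s)
open import Data.Nat.Properties
open import Data.Product using (∃; _×_; _,_; proj₁; proj₂)
open import Relation.Binary.PropositionalEquality
  using (_≡_; refl; sym; trans; cong; subst; subst₂; module ≡-Reasoning)

data Tree : Set where
  zero : Tree
  suc  : Tree → Tree
  lim  : (ℕ → Tree) → Tree

hardy : Tree → ℕ → ℕ
hardy zero    x = x
hardy (suc t) x = hardy t (suc x)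
hardy (lim f) x = hardy (f x) x

infixl 6 _⊕_
_⊕_ : Tree → Tree → Tree
s ⊕ zero  = s
s ⊕ suc t = suc (s ⊕ t)
s ⊕ lim f = lim (λ n → s ⊕ f n)

-- u · (k+1) = u + … + u; the first summand is u itself, not 0 + u.
copies : Tree → ℕ → Tree
copies u zero    = u
copies u (suc k) = copies u k ⊕ u

_·ₙ_ : Tree → ℕ → Tree
u ·ₙ zero  = zero
u ·ₙ suc k = copies u k

ω^ : Tree → Tree
ω^ zero    = suc zero
ω^ (suc t) = lim (λ n → ω^ t ·ₙ n)
ω^ (lim f) = lim (λ n → ω^ (f n))

_⊗_ : Tree → Tree → Tree
P ⊗ zero        = zero
P ⊗ suc zero    = P
P ⊗ suc (suc x) = (P ⊗ suc x) ⊕ P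
P ⊗ suc (lim f) = (P ⊗ lim f) ⊕ P
P ⊗ lim f       = lim (λ n → P ⊗ f n)

-- E^d for the epsilon tree E = lim e: E^1 = E, (E^{d+1})[n] = E^d · e n for d ≥ 1,
-- and (E^{lim f})[n] = E^{f n}.
pow : (ℕ → Tree) → Tree → Tree
pow e zero          = suc zero
pow e (suc zero)    = lim e
pow e (suc (suc d)) = lim (λ n → pow e (suc d) ⊗ e n)
pow e (suc (lim f)) = lim (λ n → pow e (lim f) ⊗ e n)
pow e (lim f)       = lim (λ n → pow e (f n))

towω-tree : ℕ → Tree
towω-tree zero    = suc zero
towω-tree (suc n) = ω^ (towω-tree n)

mutual
  εfs-tree : ℕ → ℕ → Tree
  εfs-tree zero    n = towω-tree n
  εfs-tree (suc i) n = towε-tree i n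

  towε-tree : ℕ → ℕ → Tree
  towε-tree i zero    = suc zero
  towε-tree i (suc n) = pow (εfs-tree i) (towε-tree i n)

ε-tree : ℕ → Tree
ε-tree m = lim (εfs-tree m)

data PosT : Tree → Set where
  suc⁺ : ∀ {t} → PosT (suc t)
  lim⁺ : ∀ {f} → PosT (lim f)

pos-⊕ : ∀ s {t} → PosT t → PosT (s ⊕ t)
pos-⊕ s suc⁺ = suc⁺
pos-⊕ s lim⁺ = lim⁺

pos-copies : ∀ {u} k → PosT u → PosT (copies u k)
pos-copies zero    pu = pu
pos-copies (suc k) pu = pos-⊕ _ pu

pos-ω^ : ∀ t → PosT (ω^ t)
pos-ω^ zero    = suc⁺
pos-ω^ (suc t) = lim⁺
pos-ω^ (lim f) = lim⁺

pos-⊗ : ∀ {P} x → PosT P → PosT x → PosT (P ⊗ x)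
pos-⊗ zero          _  ()
pos-⊗ (suc zero)    pP _ = pP
pos-⊗ (suc (suc x)) pP _ = pos-⊕ _ pP
pos-⊗ (suc (lim f)) pP _ = pos-⊕ _ pP
pos-⊗ (lim f)       _  _ = lim⁺

pos-pow : ∀ e d → PosT (pow e d)
pos-pow e zero          = suc⁺
pos-pow e (suc zero)    = lim⁺
pos-pow e (suc (suc d)) = lim⁺
pos-pow e (suc (lim f)) = lim⁺
pos-pow e (lim f)       = lim⁺

pos-εfs : ∀ j n → PosT (εfs-tree j n)
pos-εfs zero    zero    = suc⁺
pos-εfs zero    (suc n) = pos-ω^ _
pos-εfs (suc i) zero    = suc⁺
pos-εfs (suc i) (suc n) = pos-pow _ _

⊗-suc : ∀ {P x} → PosT x → P ⊗ suc x ≡ (P ⊗ x) ⊕ P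
⊗-suc suc⁺ = refl
⊗-suc lim⁺ = refl

pow-suc : ∀ {e d} → PosT d → pow e (suc d) ≡ lim (λ n → pow e d ⊗ e n)
pow-suc suc⁺ = refl
pow-suc lim⁺ = refl

data PosO : O → Set where
  ωt⁺ : ∀ {γ k ρ}   → PosO (ωt γ k ρ)
  εt⁺ : ∀ {j ψ ξ ρ} → PosO (εt j ψ ξ ρ)

posO-succ : ∀ {α β} → cls α ≡ isSucc β → PosO α
posO-succ {ωt _ _ _}   _ = ωt⁺
posO-succ {εt _ _ _ _} _ = εt⁺

posO-lim : ∀ {α} → cls α ≡ isLim → PosO α
posO-lim {ωt _ _ _}   _ = ωt⁺
posO-lim {εt _ _ _ _} _ = εt⁺

ω-exponent-pos : ∀ {γ k} → cls (ωt γ k 𝟎) ≡ isLim → PosO γ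
ω-exponent-pos {ωt _ _ _}   _ = ωt⁺
ω-exponent-pos {εt _ _ _ _} _ = εt⁺

-- The definitions split on the constructors of exponent and
-- tail, so these uniform equations are proved by exhausting those constructors.
ω-cls-lim : ∀ {γ} k → PosO γ → cls (ωt γ k 𝟎) ≡ isLim
ω-cls-lim k ωt⁺ = refl
ω-cls-lim k εt⁺ = refl

ω-fs-lim : ∀ {γ} k n → PosO γ → fs (ωt γ k 𝟎) n ≡ ωpre γ k (ωpow γ n)
ω-fs-lim k n ωt⁺ = refl
ω-fs-lim k n εt⁺ = refl

ε-cls-lim : ∀ j {ψ} ξ → PosO ψ → cls (εt j ψ ξ 𝟎) ≡ isLim
ε-cls-lim j ξ ωt⁺ = refl
ε-cls-lim j ξ εt⁺ = refl

ε-fs-lim : ∀ j {ψ} ξ n → PosO ψ → fs (εt j ψ ξ 𝟎) n ≡ εlast j ψ ξ n (cls ξ)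
ε-fs-lim j ξ n ωt⁺ = refl
ε-fs-lim j ξ n εt⁺ = refl

ω-cls-tail : ∀ γ k {ρ} → PosO ρ → cls (ωt γ k ρ) ≡ liftω γ k (cls ρ)
ω-cls-tail 𝟎            k ωt⁺ = refl
ω-cls-tail 𝟎            k εt⁺ = refl
ω-cls-tail (ωt _ _ _)   k ωt⁺ = refl
ω-cls-tail (ωt _ _ _)   k εt⁺ = refl
ω-cls-tail (εt _ _ _ _) k ωt⁺ = refl
ω-cls-tail (εt _ _ _ _) k εt⁺ = refl

ω-fs-tail : ∀ γ k {ρ} n → PosO ρ → fs (ωt γ k ρ) n ≡ ωt γ k (fs ρ n)
ω-fs-tail 𝟎            k n ωt⁺ = refl
ω-fs-tail 𝟎            k n εt⁺ = refl
ω-fs-tail (ωt _ _ _)   k n ωt⁺ = refl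
ω-fs-tail (ωt _ _ _)   k n εt⁺ = refl
ω-fs-tail (εt _ _ _ _) k n ωt⁺ = refl
ω-fs-tail (εt _ _ _ _) k n εt⁺ = refl

ε-cls-tail : ∀ j ψ ξ {ρ} → PosO ρ → cls (εt j ψ ξ ρ) ≡ liftε j ψ ξ (cls ρ)
ε-cls-tail j 𝟎            ξ ωt⁺ = refl
ε-cls-tail j 𝟎            ξ εt⁺ = refl
ε-cls-tail j (ωt _ _ _)   ξ ωt⁺ = refl
ε-cls-tail j (ωt _ _ _)   ξ εt⁺ = refl
ε-cls-tail j (εt _ _ _ _) ξ ωt⁺ = refl
ε-cls-tail j (εt _ _ _ _) ξ εt⁺ = refl

ε-fs-tail : ∀ j ψ ξ {ρ} n → PosO ρ → fs (εt j ψ ξ ρ) n ≡ εt j ψ ξ (fs ρ n)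
ε-fs-tail j 𝟎            ξ n ωt⁺ = refl
ε-fs-tail j 𝟎            ξ n εt⁺ = refl
ε-fs-tail j (ωt _ _ _)   ξ n ωt⁺ = refl
ε-fs-tail j (ωt _ _ _)   ξ n εt⁺ = refl
ε-fs-tail j (εt _ _ _ _) ξ n ωt⁺ = refl
ε-fs-tail j (εt _ _ _ _) ξ n εt⁺ = refl

εpre-pos : ∀ j ψ {ξ} X → PosO ξ → εpre j ψ ξ X ≡ εt j ψ ξ X
εpre-pos j ψ X ωt⁺ = refl
εpre-pos j ψ X εt⁺ = refl

ε-power-fs : ∀ j {ψ c} n → PosO ψ → cls ψ ≡ c → fs (εt j ψ one 𝟎) n ≡ εpow j ψ n c
ε-power-fs j n pψ refl = ε-fs-lim j one n pψ

data Sim : O → Tree → Set where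
  sim-zero : Sim 𝟎 zero
  sim-suc  : ∀ {α β t} → cls α ≡ isSucc β → Sim β t → Sim α (suc t)
  sim-lim  : ∀ {α f} → cls α ≡ isLim
           → (∀ n → 1 ≤ n → Sim (fs α n) (f n))
           → (∀ n → 1 ≤ n → PosT (f n))
           → Sim α (lim f)

sim-hardy : ∀ {α t} → Sim α t → ∀ x → 1 ≤ x → H α x (hardy t x)
sim-hardy sim-zero        x _   = hz refl
sim-hardy (sim-suc c s)   x _   = hs c (sim-hardy s (suc x) (s≤s z≤n))
sim-hardy (sim-lim c s _) x 1≤x = hl c (sim-hardy (s x 1≤x) x 1≤x)

sim-cast : ∀ {α β t} → α ≡ β → Sim β t → Sim α t
sim-cast refl s = s

sim-ext : ∀ {α β t} → cls α ≡ cls β → (∀ n → fs α n ≡ fs β n) → PosT t → Sim β t → Sim α t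
sim-ext c f () sim-zero
sim-ext c f _  (sim-suc c' s)    = sim-suc (trans c c') s
sim-ext c f _  (sim-lim c' s nz) = sim-lim (trans c c') (λ n q → sim-cast (f n) (s n q)) nz

sim-ε⁰ : ∀ {j ξ t} → PosT t → Sim ξ t → Sim (εt j 𝟎 ξ 𝟎) t
sim-ε⁰ = sim-ext refl (λ _ → refl)

sim-posT : ∀ {α t} → PosO α → Sim α t → PosT t
sim-posT () sim-zero
sim-posT _  (sim-suc _ _)   = suc⁺
sim-posT _  (sim-lim _ _ _) = lim⁺

data ZeroOrPos : O → Tree → Set where
  bothZero : ZeroOrPos 𝟎 zero
  bothPos  : ∀ {α t} → PosO α → PosT t → ZeroOrPos α t

zero-or-pos : ∀ {α t} → Sim α t → ZeroOrPos α t
zero-or-pos sim-zero        = bothZero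
zero-or-pos (sim-suc c _)   = bothPos (posO-succ c) suc⁺
zero-or-pos (sim-lim c _ _) = bothPos (posO-lim c) lim⁺

sim-ω-tail : ∀ {γ k ρ s t} → Sim (ωt γ k 𝟎) s → Sim ρ t → Sim (ωt γ k ρ) (s ⊕ t)
sim-ω-tail h sim-zero = h
sim-ω-tail {γ} {k} {ρ} h (sim-suc c r) =
  sim-suc (trans (ω-cls-tail γ k (posO-succ {ρ} c)) (cong (liftω γ k) c)) (sim-ω-tail h r)
sim-ω-tail {γ} {k} {ρ} {s} h (sim-lim c r nz) =
  sim-lim (trans (ω-cls-tail γ k (posO-lim {ρ} c)) (cong (liftω γ k) c))
          (λ n q → sim-cast (ω-fs-tail γ k n (posO-lim {ρ} c)) (sim-ω-tail h (r n q)))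
          (λ n q → pos-⊕ s (nz n q))

sim-ε-tail : ∀ {j ψ ξ ρ s t} → Sim (εt j ψ ξ 𝟎) s → Sim ρ t → Sim (εt j ψ ξ ρ) (s ⊕ t)
sim-ε-tail h sim-zero = h
sim-ε-tail {j} {ψ} {ξ} {ρ} h (sim-suc c r) =
  sim-suc (trans (ε-cls-tail j ψ ξ (posO-succ {ρ} c)) (cong (liftε j ψ ξ) c)) (sim-ε-tail h r)
sim-ε-tail {j} {ψ} {ξ} {ρ} {s} h (sim-lim c r nz) =
  sim-lim (trans (ε-cls-tail j ψ ξ (posO-lim {ρ} c)) (cong (liftε j ψ ξ) c))
          (λ n q → sim-cast (ε-fs-tail j ψ ξ n (posO-lim {ρ} c)) (sim-ε-tail h (r n q)))
          (λ n q → pos-⊕ s (nz n q))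

sim-one : ∀ {s} → Sim one s → s ≡ suc zero
sim-one (sim-suc refl sim-zero)           = refl
sim-one (sim-suc refl (sim-suc () _))
sim-one (sim-suc refl (sim-lim () _ _))
sim-one (sim-lim () _ _)

sim-finite : ∀ k → Sim (ωt 𝟎 k 𝟎) (copies (suc zero) k)
sim-finite zero    = sim-suc refl sim-zero
sim-finite (suc k) = sim-suc refl (sim-finite k)

sim-copies : ∀ {γ s} → Sim (ωt γ 0 𝟎) s → ∀ k → Sim (ωt γ k 𝟎) (copies s k)
sim-copies q zero = q
sim-copies {𝟎} q (suc k) =
  subst (λ s → Sim (ωt 𝟎 (suc k) 𝟎) (copies s (suc k))) (sym (sim-one q)) (sim-finite (suc k))
sim-copies {ωt _ _ _}   (sim-suc () _) (suc k)
sim-copies {εt _ _ _ _} (sim-suc () _) (suc k)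
sim-copies {γ} q@(sim-lim c r nz) (suc k) =
  sim-lim (ω-cls-lim (suc k) pγ)
          (λ n p → sim-cast (ω-fs-lim (suc k) n pγ)
                     (sim-ω-tail (sim-copies q k) (sim-cast (sym (ω-fs-lim 0 n pγ)) (r n p))))
          (λ n p → pos-⊕ _ (nz n p))
  where
  pγ : PosO γ
  pγ = ω-exponent-pos c

sim-ω^ : ∀ {γ t} → Sim γ t → Sim (ωt γ 0 𝟎) (ω^ t)
sim-ω^ sim-zero = sim-suc refl sim-zero
sim-ω^ {γ} (sim-suc c s) =
  sim-lim (ω-cls-lim 0 pγ)
          (λ { zero ()
             ; (suc k) _ → sim-cast (trans (ω-fs-lim 0 (suc k) pγ) (cong (ωpowC γ (suc k)) c))
                                    (sim-copies (sim-ω^ s) k) })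
          (λ { zero () ; (suc k) _ → pos-copies k (pos-ω^ _) })
  where
  pγ : PosO γ
  pγ = posO-succ c
sim-ω^ {γ} (sim-lim c s _) =
  sim-lim (ω-cls-lim 0 pγ)
          (λ n q → sim-cast (trans (ω-fs-lim 0 n pγ) (cong (ωpowC γ n) c)) (sim-ω^ (s n q)))
          (λ n _ → pos-ω^ _)
  where
  pγ : PosO γ
  pγ = posO-lim c

-- Successor step of products: from E^ψ ≅ P and E^ψ · ξ' ≅ P ⊗ x (ξ', x ≠ 0)
-- to E^ψ · (ξ'+1) ≅ P ⊗ (x+1), whose n-th terms are E^ψ · ξ' + E^ψ[n].
sim-⊗-suc : ∀ {j ψ P ξ ξ' x} → PosO ψ → Sim (εt j ψ one 𝟎) P → cls ξ ≡ isSucc ξ'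
          → PosO ξ' → PosT x → Sim (εt j ψ ξ' 𝟎) (P ⊗ x) → Sim (εt j ψ ξ 𝟎) (P ⊗ suc x)
sim-⊗-suc ωt⁺ (sim-suc () _) _ _ _ _
sim-⊗-suc εt⁺ (sim-suc () _) _ _ _ _
sim-⊗-suc {j} {ψ} {ξ = ξ} {ξ'} pψ (sim-lim _ r nz) c pξ' px ih =
  subst (Sim (εt j ψ ξ 𝟎)) (sym (⊗-suc px))
    (sim-lim (ε-cls-lim j ξ pψ)
             (λ n q → sim-cast (fs-eq n) (sim-ε-tail ih (sim-cast (sym (ε-fs-lim j one n pψ)) (r n q))))
             (λ n q → pos-⊕ _ (nz n q)))
  where
  fs-eq : ∀ n → fs (εt j ψ ξ 𝟎) n ≡ εt j ψ ξ' (εpow j ψ n (cls ψ))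
  fs-eq n = trans (ε-fs-lim j ξ n pψ) (trans (cong (εlast j ψ ξ n) c) (εpre-pos j ψ _ pξ'))

sim-⊗ : ∀ {j ψ P ξ x} → PosO ψ → Sim (εt j ψ one 𝟎) P → Sim ξ x → PosT x
      → Sim (εt j ψ ξ 𝟎) (P ⊗ x)
sim-⊗ {j} {ψ} {ξ = ξ} pψ E (sim-suc c r) _ with zero-or-pos r
... | bothZero =
  -- ξ has the class of 1, so E^ψ · ξ has the fundamental sequence of E^ψ
  sim-ext (trans (ε-cls-lim j ξ pψ) (sym (ε-cls-lim j one pψ)))
          (λ n → trans (ε-fs-lim j ξ n pψ) (trans (cong (εlast j ψ ξ n) c) (sym (ε-fs-lim j one n pψ))))
          (sim-posT εt⁺ E) E
... | bothPos pξ' px = sim-⊗-suc pψ E c pξ' px (sim-⊗ pψ E r px)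
sim-⊗ {j} {ψ} {ξ = ξ} pψ E (sim-lim c r nz) _ =
  sim-lim (ε-cls-lim j ξ pψ)
          (λ n q → sim-cast (trans (ε-fs-lim j ξ n pψ) (cong (εlast j ψ ξ n) c))
                             (sim-⊗ pψ E (r n q) (nz n q)))
          (λ n q → pos-⊗ _ (sim-posT εt⁺ E) (nz n q))

sim-pow : ∀ {j e} → (∀ n → 1 ≤ n → Sim (εfs j n) (e n)) → (∀ n → 1 ≤ n → PosT (e n))
        → ∀ {ψ d} → Sim ψ d → PosT d → Sim (εt j ψ one 𝟎) (pow e d)
sim-pow {j} se pe {ψ} (sim-suc c r) _ with zero-or-pos r
... | bothZero =
  sim-lim (ε-cls-lim j one pψ) (λ n q → sim-cast (ε-power-fs j n pψ c) (sim-ε⁰ (pe n q) (se n q))) pe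
  where
  pψ : PosO ψ
  pψ = posO-succ c
... | bothPos pδ pd =
  subst (Sim (εt j ψ one 𝟎)) (sym (pow-suc pd))
    (sim-lim (ε-cls-lim j one pψ)
             (λ n q → sim-cast (ε-power-fs j n pψ c) (sim-⊗ pδ (sim-pow se pe r pd) (se n q) (pe n q)))
             (λ n q → pos-⊗ _ (pos-pow _ _) (pe n q)))
  where
  pψ : PosO ψ
  pψ = posO-succ c
sim-pow {j} {e} se pe {ψ} {lim f} (sim-lim c r nz) _ =
  sim-lim (ε-cls-lim j one pψ)
          (λ n q → sim-cast (ε-power-fs j n pψ c) (sim-pow se pe (r n q) (nz n q)))
          (λ n _ → pos-pow e (f n))
  where
  pψ : PosO ψ
  pψ = posO-lim c

sim-towω : ∀ n → Sim (towω n) (towω-tree n)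
sim-towω zero    = sim-suc refl sim-zero
sim-towω (suc n) = sim-ω^ (sim-towω n)

mutual
  sim-εfs : ∀ j n → Sim (εfs j n) (εfs-tree j n)
  sim-εfs zero    n = sim-towω n
  sim-εfs (suc i) n = sim-towε i n

  sim-towε : ∀ i n → Sim (towε i n) (towε-tree i n)
  sim-towε i zero    = sim-suc refl sim-zero
  sim-towε i (suc n) =
    sim-pow (λ k _ → sim-εfs i k) (λ k _ → pos-εfs i k) (sim-towε i n) (pos-εfs (suc i) n)

sim-ε : ∀ m → Sim (ε m) (ε-tree m)
sim-ε m = sim-lim refl (λ n _ → sim-ε⁰ (pos-εfs m n) (sim-εfs m n)) (λ n _ → pos-εfs m n)

Mono : (ℕ → ℕ) → Set
Mono G = ∀ {x y} → x ≤ y → G x ≤ G y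

Infl : (ℕ → ℕ) → Set
Infl G = ∀ x → x ≤ G x

LowerBound : Tree → (ℕ → ℕ) → Set
LowerBound t G = ∀ z → 4 ≤ z → G z ≤ hardy t z

iter-unfold : ∀ (f : ℕ → ℕ) k x → iter f k (f x) ≡ iter f (suc k) x
iter-unfold f zero    x = refl
iter-unfold f (suc k) x = cong f (iter-unfold f k x)

iter-mono : ∀ {f} k → Mono f → Mono (iter f k)
iter-mono zero    mf p = p
iter-mono (suc k) mf p = mf (iter-mono k mf p)

iter-infl : ∀ {f} k → Infl f → Infl (iter f k)
iter-infl zero    inf x = ≤-refl
iter-infl {f} (suc k) inf x = ≤-trans (iter-infl k inf x) (inf (iter f k x))

iter-count : ∀ {f} → Infl f → ∀ {j k} x → j ≤ k → iter f j x ≤ iter f k x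
iter-count inf {zero} {k} x _ = iter-infl k inf x
iter-count {f} inf {suc j} {suc k} x (s≤s p) =
  subst₂ _≤_ (iter-unfold f j x) (iter-unfold f k x) (iter-count inf (f x) p)

iter-suc≤iter² : ∀ {f} → Mono f → Infl f → ∀ n → 1 ≤ n → ∀ z
               → iter f (suc n) z ≤ iter f n (iter f n z)
iter-suc≤iter² {f} mf inf n 1≤n z =
  subst (_≤ iter f n (iter f n z)) (iter-unfold f n z)
        (iter-mono n mf (iter-count inf {1} {n} z 1≤n))

iter-≤-mono-inner : ∀ {g f : ℕ → ℕ} c → Mono g → (∀ w → c ≤ w → g w ≤ f w) → Infl f
                  → ∀ k x → c ≤ x → iter g k x ≤ iter f k x
iter-≤-mono-inner c mg le inf zero    x p = ≤-refl
iter-≤-mono-inner c mg le inf (suc k) x p =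
  ≤-trans (mg (iter-≤-mono-inner c mg le inf k x p)) (le _ (≤-trans p (iter-infl k inf x)))

iter-above : ∀ {g : ℕ → ℕ} c → (∀ w → c ≤ w → c ≤ g w) → ∀ k x → c ≤ x → c ≤ iter g k x
iter-above c h zero    x p = p
iter-above c h (suc k) x p = h _ (iter-above c h k x p)

iter-≤-mono-outer : ∀ {g f : ℕ → ℕ} c → Mono f → (∀ w → c ≤ w → g w ≤ f w)
                  → (∀ w → c ≤ w → c ≤ g w)
                  → ∀ k x → c ≤ x → iter g k x ≤ iter f k x
iter-≤-mono-outer c mf le cg zero    x p = ≤-refl
iter-≤-mono-outer c mf le cg (suc k) x p =
  ≤-trans (le _ (iter-above c cg k x p)) (mf (iter-≤-mono-outer c mf le cg k x p))

hardy-⊕ : ∀ s t x → hardy (s ⊕ t) x ≡ hardy s (hardy t x)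
hardy-⊕ s zero    x = refl
hardy-⊕ s (suc t) x = hardy-⊕ s t (suc x)
hardy-⊕ s (lim f) x = hardy-⊕ s (f x) x

hardy-infl : ∀ t → Infl (hardy t)
hardy-infl zero    x = ≤-refl
hardy-infl (suc t) x = ≤-trans (n≤1+n x) (hardy-infl t (suc x))
hardy-infl (lim f) x = hardy-infl (f x) x

hardy-copies : ∀ u k x → hardy (copies u k) x ≡ iter (hardy u) (suc k) x
hardy-copies u zero    x = refl
hardy-copies u (suc k) x = begin
  hardy (copies u k ⊕ u) x          ≡⟨ hardy-⊕ (copies u k) u x ⟩
  hardy (copies u k) (hardy u x)    ≡⟨ hardy-copies u k (hardy u x) ⟩
  iter (hardy u) (suc k) (hardy u x) ≡⟨ cong (hardy u) (iter-unfold (hardy u) k x) ⟩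
  iter (hardy u) (suc (suc k)) x    ∎
  where open ≡-Reasoning

hardy-·ₙ : ∀ u n x → hardy (u ·ₙ n) x ≡ iter (hardy u) n x
hardy-·ₙ u zero    x = refl
hardy-·ₙ u (suc k) x = hardy-copies u k x

-- AtLeast t k: t is at least the finite ordinal k, robustly: at limits the
-- claim is required for every branch n ≥ 4.
data AtLeast : Tree → ℕ → Set where
  at-zero : ∀ {t} → AtLeast t 0
  at-suc  : ∀ {t k} → AtLeast t k → AtLeast (suc t) (suc k)
  at-skip : ∀ {t k} → AtLeast t k → AtLeast (suc t) k
  at-lim  : ∀ {f k} → (∀ n → 4 ≤ n → AtLeast (f n) k) → AtLeast (lim f) k

at-down : ∀ {t j i} → AtLeast t j → i ≤ j → AtLeast t i
at-down a           z≤n     = at-zero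
at-down (at-suc a)  (s≤s p) = at-suc (at-down a p)
at-down (at-skip a) p       = at-skip (at-down a p)
at-down (at-lim a)  p       = at-lim (λ n q → at-down (a n q) p)

at-⊕ˡ : ∀ {A i} → AtLeast A i → ∀ B → AtLeast (A ⊕ B) i
at-⊕ˡ a zero    = a
at-⊕ˡ a (suc B) = at-skip (at-⊕ˡ a B)
at-⊕ˡ a (lim f) = at-lim (λ n _ → at-⊕ˡ a (f n))

at-⊕ : ∀ {A B i l} → AtLeast B l → AtLeast A i → AtLeast (A ⊕ B) (l + i)
at-⊕ {B = B} at-zero aA = at-⊕ˡ aA B
at-⊕ (at-suc a)  aA = at-suc (at-⊕ a aA)
at-⊕ (at-skip a) aA = at-skip (at-⊕ a aA)
at-⊕ (at-lim a)  aA = at-lim (λ n q → at-⊕ (a n q) aA)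

at-copies : ∀ {u l} → AtLeast u l → ∀ k → AtLeast (copies u k) l
at-copies a zero = a
at-copies {u} {l} a (suc k) = subst (AtLeast (copies u k ⊕ u)) (+-identityʳ l) (at-⊕ a at-zero)

at-ω^-1 : ∀ t → AtLeast (ω^ t) 1
at-ω^-1 zero    = at-suc at-zero
at-ω^-1 (suc t) = at-lim (λ { zero () ; (suc k) _ → at-copies (at-ω^-1 t) k })
at-ω^-1 (lim f) = at-lim (λ n _ → at-ω^-1 (f n))

at-ω^ : ∀ {t j} → AtLeast t j → AtLeast (ω^ t) (suc j)
at-ω^ {t} at-zero = at-ω^-1 t
at-ω^ {suc t} (at-suc a) =
  at-lim (λ { (suc (suc k)) _ → at-⊕ (at-ω^-1 t) (at-copies (at-ω^ a) k) ; (suc zero) (s≤s ()) })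
at-ω^ (at-skip a) = at-lim (λ { zero () ; (suc k) _ → at-copies (at-ω^ a) k })
at-ω^ (at-lim a)  = at-lim (λ n q → at-ω^ (a n q))

-- The tower trees: ω = lim_n n is robustly ≥ 4, so tow_{k+2}(ω) is robustly ≥ 5.
at-ones : ∀ n → AtLeast (suc zero ·ₙ n) n
at-ones zero    = at-zero
at-ones (suc n) = ones n
  where
  ones : ∀ k → AtLeast (copies (suc zero) k) (suc k)
  ones zero    = at-suc at-zero
  ones (suc k) = at-suc (ones k)

at-towω : ∀ k → AtLeast (towω-tree (suc (suc k))) 5
at-towω zero    = at-ω^ (at-lim (λ n q → at-down (at-ones n) q))
at-towω (suc k) = at-down (at-ω^ (at-towω k)) (n≤1+n 5)

at-⊗ : ∀ {P X k} → AtLeast P 1 → AtLeast X k → AtLeast (P ⊗ X) k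
at-⊗ aP at-zero = at-zero
at-⊗ {X = suc zero}    aP (at-suc at-zero) = aP
at-⊗ {X = suc (suc x)} aP (at-suc a)       = at-⊕ aP (at-⊗ aP a)
at-⊗ {X = suc (lim f)} aP (at-suc a)       = at-⊕ aP (at-⊗ aP a)
at-⊗ {X = suc zero}    aP (at-skip at-zero) = at-zero
at-⊗ {P} {X = suc (suc x)} aP (at-skip a)  = at-⊕ˡ (at-⊗ aP a) P
at-⊗ {P} {X = suc (lim f)} aP (at-skip a)  = at-⊕ˡ (at-⊗ aP a) P
at-⊗ aP (at-lim a) = at-lim (λ n q → at-⊗ aP (a n q))

data Regular : Tree → Set where
  reg-zero : Regular zero
  reg-suc  : ∀ {t} → Regular t → Regular (suc t)
  reg-lim  : ∀ {f} → (∀ n → 1 ≤ n → PosT (f n) × Regular (f n)) → Regular (lim f)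

sim-regular : ∀ {α t} → Sim α t → Regular t
sim-regular sim-zero         = reg-zero
sim-regular (sim-suc _ s)    = reg-suc (sim-regular s)
sim-regular (sim-lim _ s nz) = reg-lim (λ n q → nz n q , sim-regular (s n q))

1≤-of-4≤ : ∀ {z} → 4 ≤ z → 1 ≤ z
1≤-of-4≤ = ≤-trans (s≤s z≤n)

A : ℕ → ℕ → ℕ
A zero    z = suc z
A (suc k) z = iter (A k) z z

A-infl : ∀ k → Infl (A k)
A-infl zero    x = n≤1+n x
A-infl (suc k) x = iter-infl x (A-infl k) x

A-mono : ∀ k → Mono (A k)
A-mono zero    p = s≤s p
A-mono (suc k) {x} {y} p = ≤-trans (iter-mono x (A-mono k) p) (iter-count (A-infl k) y p)

-- Every ω-power is ≥ 1, so its Hardy function is at least the successor.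
ω^-above-suc : ∀ t z → 1 ≤ z → suc z ≤ hardy (ω^ t) z
ω^-above-suc zero    z _ = ≤-refl
ω^-above-suc (suc t) (suc k) p rewrite hardy-·ₙ (ω^ t) (suc k) (suc k) =
  ≤-trans (s≤s (iter-infl k (hardy-infl (ω^ t)) (suc k)))
          (ω^-above-suc t (iter (hardy (ω^ t)) k (suc k)) (≤-trans p (iter-infl k (hardy-infl (ω^ t)) (suc k))))
ω^-above-suc (lim f) z p = ω^-above-suc (f z) z p

ω^-lower : ∀ {t k} → AtLeast t k → LowerBound (ω^ t) (A k)
ω^-lower {t} at-zero z p = ω^-above-suc t z (1≤-of-4≤ p)
ω^-lower {suc t} {suc k} (at-suc a) z p rewrite hardy-·ₙ (ω^ t) z z =
  iter-≤-mono-inner 4 (A-mono k) (ω^-lower a) (hardy-infl (ω^ t)) z z p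
ω^-lower {suc t} {k} (at-skip a) (suc z) p rewrite hardy-·ₙ (ω^ t) (suc z) (suc z) =
  ≤-trans (A-mono k (iter-infl z (hardy-infl (ω^ t)) (suc z)))
          (ω^-lower a _ (≤-trans p (iter-infl z (hardy-infl (ω^ t)) (suc z))))
ω^-lower (at-lim a) z p = ω^-lower (a z p) z p

module _ {P : Tree} {G : ℕ → ℕ} (P≥G : LowerBound P G) (mG : Mono G) where

  ⊗-step : ∀ {k} X → (∀ w → 4 ≤ w → iter G k w ≤ hardy (P ⊗ X) w)
         → ∀ z → 4 ≤ z → iter G (suc k) z ≤ hardy ((P ⊗ X) ⊕ P) z
  ⊗-step {k} X ih z p rewrite hardy-⊕ (P ⊗ X) P z =
    ≤-trans (≤-reflexive (sym (iter-unfold G k z)))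
      (≤-trans (iter-mono k mG (P≥G z p)) (ih (hardy P z) (≤-trans p (hardy-infl P z))))

  ⊗-skip : ∀ {k} X → (∀ w → 4 ≤ w → iter G k w ≤ hardy (P ⊗ X) w)
         → ∀ z → 4 ≤ z → iter G k z ≤ hardy ((P ⊗ X) ⊕ P) z
  ⊗-skip {k} X ih z p rewrite hardy-⊕ (P ⊗ X) P z =
    ≤-trans (iter-mono k mG (hardy-infl P z)) (ih (hardy P z) (≤-trans p (hardy-infl P z)))

  ⊗-lower : ∀ {X k} → AtLeast X k → ∀ z → 4 ≤ z → iter G k z ≤ hardy (P ⊗ X) z
  ⊗-lower {X} at-zero z p = hardy-infl (P ⊗ X) z
  ⊗-lower {suc zero}    (at-suc at-zero) = P≥G
  ⊗-lower {suc (suc x)} {suc k} (at-suc a) = ⊗-step {k} (suc x) (⊗-lower a)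
  ⊗-lower {suc (lim f)} {suc k} (at-suc a) = ⊗-step {k} (lim f) (⊗-lower a)
  ⊗-lower {suc zero}    (at-skip at-zero) z p = hardy-infl P z
  ⊗-lower {suc (suc x)} {k} (at-skip a) = ⊗-skip {k} (suc x) (⊗-lower a)
  ⊗-lower {suc (lim f)} {k} (at-skip a) = ⊗-skip {k} (lim f) (⊗-lower a)
  ⊗-lower (at-lim a) z p = ⊗-lower (a z p) z p

module _ (e : ℕ → Tree) (e≥2 : ∀ n → 4 ≤ n → AtLeast (e n) 2) where

  e≥1 : ∀ n → 4 ≤ n → AtLeast (e n) 1
  e≥1 n q = at-down (e≥2 n q) (s≤s z≤n)

  at-pow-1 : ∀ d → AtLeast (pow e d) 1
  at-pow-1 zero          = at-suc at-zero
  at-pow-1 (suc zero)    = at-lim e≥1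
  at-pow-1 (suc (suc d)) = at-lim (λ n q → at-⊗ (at-pow-1 (suc d)) (e≥1 n q))
  at-pow-1 (suc (lim f)) = at-lim (λ n q → at-⊗ (at-pow-1 (lim f)) (e≥1 n q))
  at-pow-1 (lim f)       = at-lim (λ n _ → at-pow-1 (f n))

  at-pow-2 : ∀ {d} → Regular d → PosT d → AtLeast (pow e d) 2
  at-pow-2 {suc zero}    _ _ = at-lim e≥2
  at-pow-2 {suc (suc d)} _ _ = at-lim (λ n q → at-⊗ (at-pow-1 (suc d)) (e≥2 n q))
  at-pow-2 {suc (lim f)} _ _ = at-lim (λ n q → at-⊗ (at-pow-1 (lim f)) (e≥2 n q))
  at-pow-2 {lim f} (reg-lim r) _ =
    at-lim (λ n q → at-pow-2 (proj₂ (r n (1≤-of-4≤ q))) (proj₁ (r n (1≤-of-4≤ q))))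

  -- If a monotone G bounds E from below, then G bounds every nonzero power of E,
  -- and G ∘ G every power with exponent ≥ 2 (then E^d[n] ≥ E^{d'} · e n with e n ≥ 2).
  module _ {G : ℕ → ℕ} (E≥G : LowerBound (lim e) G) (mG : Mono G) where

    pow-lower₁ : ∀ {d} → Regular d → PosT d → LowerBound (pow e d) G
    pow-lower₁ {suc zero} _ _ = E≥G
    pow-lower₁ {suc (suc d)} (reg-suc r) _ z p = ⊗-lower (pow-lower₁ r suc⁺) mG (e≥1 z p) z p
    pow-lower₁ {suc (lim f)} (reg-suc r) _ z p = ⊗-lower (pow-lower₁ r lim⁺) mG (e≥1 z p) z p
    pow-lower₁ {lim f} (reg-lim r) _ z p =
      pow-lower₁ (proj₂ (r z (1≤-of-4≤ p))) (proj₁ (r z (1≤-of-4≤ p))) z p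

    pow-lower₂ : ∀ {d} → Regular d → AtLeast d 2 → LowerBound (pow e d) (λ z → G (G z))
    pow-lower₂ {suc zero} _ (at-suc ())
    pow-lower₂ {suc zero} _ (at-skip ())
    pow-lower₂ {suc (suc d)} (reg-suc r) (at-suc _) z p = ⊗-lower (pow-lower₁ r suc⁺) mG (e≥2 z p) z p
    pow-lower₂ {suc (lim f)} (reg-suc r) (at-suc _) z p = ⊗-lower (pow-lower₁ r lim⁺) mG (e≥2 z p) z p
    pow-lower₂ {suc (suc d)} (reg-suc r) (at-skip a) z p =
      ⊗-lower (pow-lower₂ r a) (λ q → mG (mG q)) (e≥1 z p) z p
    pow-lower₂ {suc (lim f)} (reg-suc r) (at-skip a) z p =
      ⊗-lower (pow-lower₂ r a) (λ q → mG (mG q)) (e≥1 z p) z p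
    pow-lower₂ {lim f} (reg-lim r) (at-lim a) z p =
      pow-lower₂ (proj₂ (r z (1≤-of-4≤ p))) (a z p) z p

mutual
  at-εfs : ∀ m n → 4 ≤ n → AtLeast (εfs-tree m n) 2
  at-εfs zero    (suc (suc k)) (s≤s (s≤s _)) = at-down (at-towω k) (s≤s (s≤s z≤n))
  at-εfs (suc i) (suc k)       _             = at-towε i k

  at-towε : ∀ m k → AtLeast (towε-tree m (suc k)) 2
  at-towε m k = at-pow-2 (εfs-tree m) (at-εfs m) (sim-regular (sim-towε m k)) (pos-εfs (suc m) k)

S : ℕ → ℕ
S y = y ^ y

S-mono : Mono S
S-mono {zero}  {zero}  _ = ≤-refl
S-mono {zero}  {suc y} _ = m^n>0 (suc y) (suc y)
S-mono {suc x} {suc y} p = ≤-trans (^-monoˡ-≤ (suc x) p) (^-monoʳ-≤ (suc y) p)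

S-infl : Infl S
S-infl zero    = z≤n
S-infl (suc y) =
  ≤-trans (≤-reflexive (sym (^-identityʳ (suc y)))) (^-monoʳ-≤ (suc y) {1} {suc y} (s≤s z≤n))

F : ℕ → ℕ
F z = iter S z z

F-infl : Infl F
F-infl x = iter-infl x S-infl x

F-mono : Mono F
F-mono {x} {y} p = ≤-trans (iter-mono x S-mono p) (iter-count S-infl y p)

iter-suc : ∀ n x → iter suc n x ≡ n + x
iter-suc zero    x = refl
iter-suc (suc n) x = cong suc (iter-suc n x)

double : ∀ x → 2 * x ≡ x + x
double x = cong (x +_) (+-identityʳ x)

-- A 1 doubles, so its j-th iterate multiplies by 2^j.
2^j*≤A1-iter : ∀ j v → 2 ^ j * v ≤ iter (A 1) j v
2^j*≤A1-iter zero    v = ≤-reflexive (*-identityˡ v)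
2^j*≤A1-iter (suc j) v = begin
  2 ^ suc j * v                           ≡⟨ trans (*-assoc 2 (2 ^ j) v) (double (2 ^ j * v)) ⟩
  2 ^ j * v + 2 ^ j * v                   ≤⟨ +-mono-≤ (2^j*≤A1-iter j v) (2^j*≤A1-iter j v) ⟩
  iter (A 1) j v + iter (A 1) j v         ≡⟨ sym (iter-suc (iter (A 1) j v) (iter (A 1) j v)) ⟩
  iter (A 1) (suc j) v                    ∎
  where open ≤-Reasoning

2^≤A2 : ∀ u → 1 ≤ u → 2 ^ u ≤ A 2 u
2^≤A2 (suc u) _ = ≤-trans (m≤m*n (2 ^ suc u) (suc u)) (2^j*≤A1-iter (suc u) (suc u))

n≤2^n : ∀ n → n ≤ 2 ^ n
n≤2^n zero    = z≤n
n≤2^n (suc n) = ≤-trans (+-mono-≤ (m^n>0 2 n) (n≤2^n n)) (≤-reflexive (sym (double (2 ^ n))))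

S≤A3 : ∀ w → 2 ≤ w → S w ≤ A 3 w
S≤A3 w 2≤w = begin
  w ^ w                   ≤⟨ ^-monoˡ-≤ w (≤-trans (n≤2^n w) (^-monoʳ-≤ 2 (n≤2^n w))) ⟩
  (2 ^ 2 ^ w) ^ w         ≡⟨ ^-*-assoc 2 (2 ^ w) w ⟩
  2 ^ (2 ^ w * w)         ≤⟨ ^-monoʳ-≤ 2 (2^j*≤A1-iter w w) ⟩
  2 ^ A 2 w               ≤⟨ 2^≤A2 (A 2 w) (≤-trans (≤-trans (s≤s z≤n) 2≤w) (A-infl 2 w)) ⟩
  A 2 (A 2 w)             ≤⟨ iter-count (A-infl 2) w 2≤w ⟩
  A 3 w                   ∎
  where open ≤-Reasoning

F≤A4 : ∀ z → 2 ≤ z → F z ≤ A 4 z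
F≤A4 z 2≤z = iter-≤-mono-inner 2 S-mono S≤A3 (A-infl 3) z z 2≤z

F⁴≤A5 : ∀ z → 4 ≤ z → iter F 4 z ≤ A 5 z
F⁴≤A5 z 4≤z =
  ≤-trans (iter-count F-infl z 4≤z)
          (iter-≤-mono-inner 2 F-mono F≤A4 (A-infl 4) z z (≤-trans (s≤s (s≤s z≤n)) 4≤z))

-- The Hardy function of ε_m dominates F^(4+m) on arguments ≥ 4:
-- for m = 0 via hardy (ω^ t) ≥ A 5 ≥ F⁴, and for m+1 because
-- ε_{m+1}[z] = tow_z(ε_m) is a power of ε_m with exponent ≥ 2.
ε-tree-lower : ∀ m → LowerBound (ε-tree m) (iter F (4 + m))
ε-tree-lower zero z@(suc (suc (suc (suc n)))) p@(s≤s (s≤s (s≤s (s≤s _)))) =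
  ≤-trans (F⁴≤A5 z p) (ω^-lower (at-towω (suc n)) z p)
ε-tree-lower (suc m) z@(suc (suc k)) p@(s≤s (s≤s _)) =
  ≤-trans (iter-suc≤iter² {F} F-mono F-infl (4 + m) (s≤s z≤n) z)
          (pow-lower₂ (εfs-tree m) (at-εfs m) (ε-tree-lower m) (iter-mono (4 + m) F-mono)
                      (sim-regular (sim-towε m (suc k))) (at-towε m k) z p)

tow-pos : ∀ n w → 1 ≤ w → 1 ≤ tow n w
tow-pos zero    w       _ = s≤s z≤n
tow-pos (suc n) (suc w) _ = m^n>0 (suc w) (tow n (suc w))

tow-infl : ∀ n w → 1 ≤ n → 1 ≤ w → w ≤ tow n w
tow-infl (suc n) (suc w) _ p =
  ≤-trans (≤-reflexive (sym (^-identityʳ (suc w))))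
          (^-monoʳ-≤ (suc w) {1} {tow n (suc w)} (tow-pos n (suc w) p))

tow≤S-iter : ∀ n w → 1 ≤ w → tow (suc n) w ≤ iter S n w
tow≤S-iter zero    w       _ = ≤-reflexive (^-identityʳ w)
tow≤S-iter (suc n) (suc w) p =
  ≤-trans (^-monoʳ-≤ (suc w) (tow≤S-iter n (suc w) p))
          (^-monoˡ-≤ (iter S n (suc w)) (iter-infl n S-infl (suc w)))

tow≤F : ∀ a w → 1 ≤ a → a ≤ w → tow a w ≤ F w
tow≤F (suc a) w _ a<w =
  ≤-trans (tow≤S-iter a w (≤-trans (s≤s z≤n) a<w)) (iter-count S-infl w (≤-trans (n≤1+n a) a<w))

2*<F : ∀ y → 3 ≤ y → 2 * y < F y
2*<F y@(suc _) 3≤y = begin-strict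
  2 * y       <⟨ *-monoˡ-< y {2} {3} ≤-refl ⟩
  3 * y       ≤⟨ *-monoˡ-≤ y 3≤y ⟩
  y * y       ≡⟨ cong (y *_) (sym (*-identityʳ y)) ⟩
  y ^ 2       ≤⟨ ^-monoʳ-≤ y (≤-trans (s≤s (s≤s z≤n)) 3≤y) ⟩
  y ^ y       ≤⟨ iter-count S-infl {1} {y} y (≤-trans (s≤s z≤n) 3≤y) ⟩
  F y         ∎
  where open ≤-Reasoning

-- k iterated towers tow_a started at a+1 stay below F^(k+1)(a): tow_a ≤ F
-- above a, F is monotone and a+1 ≤ F a.
towers≤F-iter : ∀ a k → 4 ≤ a → iter (tow a) k (suc a) ≤ iter F (suc k) a
towers≤F-iter a k 4≤a = begin
  iter (tow a) k (suc a)
    ≤⟨ iter-≤-mono-outer a F-mono (λ w → tow≤F a w 1≤a) tow-above k (suc a) (n≤1+n a) ⟩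
  iter F k (suc a)       ≤⟨ iter-mono k F-mono a<F ⟩
  iter F k (F a)         ≡⟨ iter-unfold F k a ⟩
  iter F (suc k) a       ∎
  where
  open ≤-Reasoning
  1≤a : 1 ≤ a
  1≤a = 1≤-of-4≤ 4≤a
  tow-above : ∀ w → a ≤ w → a ≤ tow a w
  tow-above w a≤w = ≤-trans a≤w (tow-infl a w 1≤a (≤-trans 1≤a a≤w))
  a<F : suc a ≤ F a
  a<F = ≤-trans (s≤s (m≤m+n a (a + 0))) (2*<F a (≤-trans (n≤1+n 3) 4≤a))

-- The theorem: h_{ε_m}(a) = hardy (ε-tree m) a ≥ F(Y) > 2Y for Y = F^(3+m)(a),
-- and Y bounds the m+2 iterated towers.
mainTheorem10 : (m a : ℕ) → 3 < a →
  ∃ λ y → H (ε m) a y × 2 * iter (tow a) (m + 2) (suc a) < y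
mainTheorem10 m a 4≤a = hardy (ε-tree m) a , sim-hardy (sim-ε m) a (1≤-of-4≤ 4≤a) , bound
  where
  open ≤-Reasoning
  Y : ℕ
  Y = iter F (3 + m) a

  3≤Y : 3 ≤ Y
  3≤Y = ≤-trans (n≤1+n 3) (≤-trans 4≤a (iter-infl (3 + m) F-infl a))

  bound : 2 * iter (tow a) (m + 2) (suc a) < hardy (ε-tree m) a
  bound = begin-strict
    2 * iter (tow a) (m + 2) (suc a) ≡⟨ cong (λ k → 2 * iter (tow a) k (suc a)) (+-comm m 2) ⟩
    2 * iter (tow a) (2 + m) (suc a) ≤⟨ *-monoʳ-≤ 2 (towers≤F-iter a (2 + m) 4≤a) ⟩
    2 * Y                            <⟨ 2*<F Y 3≤Y ⟩
    F Y                              ≤⟨ ε-tree-lower m a 4≤a ⟩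
    hardy (ε-tree m) a               ∎
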